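{- Let $k \ge 0$ be an integer. Suppose we are given four pairwise disjoint piles $A$, $B$, $C$, $D$ of identical-looking coins, each of size $2^k$, and exactly two of the coins are counterfeit. It is known that either one counterfeit coin lies in $A$ and the other in $B$, or one counterfeit coin lies in $C$ and the other in $D$. Then there is an adaptive weighing strategy using a 5-way scale that is guaranteed to identify both counterfeit coins using at most $k+1$ weighings.
   Context: All real coins have the same weight; the two counterfeit coins have the same weight as each other, which is strictly less than that of a real coin. A weighing on the 5-way scale places the same number of coins on each of two pans. Let $d$ be (number of counterfeit coins on the left pan) minus (number of counterfeit coins on the right pan). The scale reports MUCH LESS if $d \ge 2$, LESS if $d = 1$, EQUAL if $d = 0$, MORE if $d = -1$, and MUCH MORE if $d \le -2$. A strategy is adaptive: the choice of each weighing may depend on the outcomes of the previous ones. -}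

module Defs where

open import Data.Nat using (ℕ; zero; suc; _*_; _^_; _≤ᵇ_; _≡ᵇ_)
open import Data.Bool using (if_then_else_)
open import Data.Fin using (Fin; combine; zero; suc)
open import Data.Fin.Subset using (Subset; _∩_; _∪_; ⁅_⁆; ∣_∣; ⊥)
open import Data.Product using (∃-syntax; _×_)
open import Data.Sum using (_⊎_)
open import Relation.Binary.PropositionalEquality using (_≡_)

data Outcome : Set where
  muchLess less equal more muchMore : Outcome

reading : ℕ → ℕ → Outcome
reading l r =
  if suc (suc r) ≤ᵇ l then muchLess
  else if suc r ≡ᵇ l then less
  else if l ≡ᵇ r then equal
  else if suc l ≡ᵇ r then more
  else muchMore

weighing : ∀ {n} → Subset n → Subset n → Subset n → Outcome
weighing L R S = reading ∣ L ∩ S ∣ ∣ R ∩ S ∣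

-- Adaptive strategies on n coins using at most m weighings: a decision tree.
data Strategy (n : ℕ) : ℕ → Set where
  leaf : ∀ {m} → Subset n → Strategy n m
  node : ∀ {m} → (L R : Subset n) → L ∩ R ≡ ⊥ → ∣ L ∣ ≡ ∣ R ∣ →
         (Outcome → Strategy n m) → Strategy n (suc m)

run : ∀ {n m} → Strategy n m → Subset n → Subset n
run (leaf G) S = G
run (node L R _ _ next) S = run (next (weighing L R S)) S

Coin : ℕ → Set
Coin k = Fin (4 * 2 ^ k)

coin : ∀ k → Fin 4 → Fin (2 ^ k) → Coin k
coin k p j = combine p j

pA pB pC pD : Fin 4
pA = zero
pB = suc zero
pC = suc (suc zero)
pD = suc (suc (suc zero))

Admissible : ∀ k → Subset (4 * 2 ^ k) → Set
Admissible k S =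
  (∃[ a ] ∃[ b ] S ≡ ⁅ coin k pA a ⁆ ∪ ⁅ coin k pB b ⁆)
  ⊎ (∃[ c ] ∃[ d ] S ≡ ⁅ coin k pC c ⁆ ∪ ⁅ coin k pD d ⁆)

-- Keep four disjoint piles A, B, C, D of 2^j coins, with the counterfeits one in A and one in B or
-- one in C and one in D.  Halve every pile, X = X₁ ∪ X₂, and weigh A₁ ∪ B₁ against C₁ ∪ D₁: an A–B pair
-- tips the scale left by the number of its coins in first halves and a C–D pair tips it right, so
-- MUCH LESS means A₁B₁, LESS means A₁B₂ or A₂B₁, EQUAL means A₂B₂ or C₂D₂, and symmetrically.  The
-- candidates again form four disjoint piles of 2^(j-1) coins with the same promise, so after k weighings
-- every pile is a single coin and weighing A ∪ B against C ∪ D names the pair.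

module Submission where

open import Defs
open import Data.Bool using (Bool; true; false; _∧_; _∨_)
open import Data.Bool.Properties using (∧-identityʳ)
open import Data.Fin using (Fin; zero; suc; _↑ˡ_; _↑ʳ_; combine; remQuot)
open import Data.Fin.Properties using (_≟_; all?; combine-remQuot)
open import Data.Fin.Subset using (Subset; _∩_; _∪_; ⁅_⁆; ∣_∣; ⊥; ⊤)
open import Data.Fin.Subset.Properties
  using (∩-comm; ∩-idem; ∩-zeroˡ; ∩-zeroʳ; ∪-comm; ∪-identityˡ; ∩-distribˡ-∪; ∩-distribʳ-∪; ∣⊥∣≡0; ∣⊤∣≡n)
open import Data.Nat using (ℕ; zero; suc; _+_; _*_; _^_)
open import Data.Nat.Properties using (+-suc; +-comm; +-identityʳ)
open import Data.Product using (Σ; _×_; _,_; proj₁; proj₂)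
open import Data.Product.Properties using (≡-dec; ,-injectiveˡ)
open import Data.Sum using (inj₁; inj₂)
open import Data.Vec using (_∷_; []; _++_; lookup)
open import Data.Vec.Properties using (lookup-++ˡ; lookup-++ʳ; lookup-zipWith; lookup-replicate; zipWith-++; ∷-injectiveʳ)
open import Function using (_∘_)
open import Function.Definitions using (Injective)
open import Relation.Binary.Definitions using (DecidableEquality)
open import Relation.Binary.PropositionalEquality
open import Relation.Nullary using (Dec; does; yes; no; contradiction)
open import Relation.Nullary.Decidable using (True; toWitness; _→-dec_)

toℕ : Bool → ℕ
toℕ false = 0
toℕ true  = 1

∣p++q∣≡∣p∣+∣q∣ : ∀ {m n} (p : Subset m) (q : Subset n) → ∣ p ++ q ∣ ≡ ∣ p ∣ + ∣ q ∣
∣p++q∣≡∣p∣+∣q∣ []          q = refl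
∣p++q∣≡∣p∣+∣q∣ (true  ∷ p) q = cong suc (∣p++q∣≡∣p∣+∣q∣ p q)
∣p++q∣≡∣p∣+∣q∣ (false ∷ p) q = ∣p++q∣≡∣p∣+∣q∣ p q

⊥++⊥ : ∀ m {n} → ⊥ {m} ++ ⊥ {n} ≡ ⊥
⊥++⊥ zero    = refl
⊥++⊥ (suc m) = cong (false ∷_) (⊥++⊥ m)

∣p∪q∣≡∣p∣+∣q∣ : ∀ {n} (p q : Subset n) → p ∩ q ≡ ⊥ → ∣ p ∪ q ∣ ≡ ∣ p ∣ + ∣ q ∣
∣p∪q∣≡∣p∣+∣q∣ []          []          _  = refl
∣p∪q∣≡∣p∣+∣q∣ (true  ∷ p) (true  ∷ q) ()
∣p∪q∣≡∣p∣+∣q∣ (true  ∷ p) (false ∷ q) eq = cong suc (∣p∪q∣≡∣p∣+∣q∣ p q (∷-injectiveʳ eq))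
∣p∪q∣≡∣p∣+∣q∣ (false ∷ p) (true  ∷ q) eq =
  trans (cong suc (∣p∪q∣≡∣p∣+∣q∣ p q (∷-injectiveʳ eq))) (sym (+-suc ∣ p ∣ ∣ q ∣))
∣p∪q∣≡∣p∣+∣q∣ (false ∷ p) (false ∷ q) eq = ∣p∪q∣≡∣p∣+∣q∣ p q (∷-injectiveʳ eq)

∪-∩-∪≡⊥ : ∀ {n} {p q r s : Subset n} →
           p ∩ r ≡ ⊥ → p ∩ s ≡ ⊥ → q ∩ r ≡ ⊥ → q ∩ s ≡ ⊥ → (p ∪ q) ∩ (r ∪ s) ≡ ⊥
∪-∩-∪≡⊥ {p = p} {q} {r} {s} pr ps qr qs = begin
  (p ∪ q) ∩ (r ∪ s)                   ≡⟨ ∩-distribʳ-∪ (r ∪ s) p q ⟩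
  p ∩ (r ∪ s) ∪ q ∩ (r ∪ s)           ≡⟨ cong₂ _∪_ (∩-distribˡ-∪ p r s) (∩-distribˡ-∪ q r s) ⟩
  (p ∩ r ∪ p ∩ s) ∪ (q ∩ r ∪ q ∩ s)   ≡⟨ cong₂ _∪_ (cong₂ _∪_ pr ps) (cong₂ _∪_ qr qs) ⟩
  (⊥ ∪ ⊥) ∪ (⊥ ∪ ⊥)                   ≡⟨ cong₂ _∪_ (∪-identityˡ ⊥) (∪-identityˡ ⊥) ⟩
  ⊥ ∪ ⊥                               ≡⟨ ∪-identityˡ ⊥ ⟩
  ⊥                                   ∎
  where open ≡-Reasoning

∣p∩⊥∣≡0 : ∀ {n} (p : Subset n) → ∣ p ∩ ⊥ ∣ ≡ 0
∣p∩⊥∣≡0 {n} p = trans (cong ∣_∣ (∩-zeroʳ p)) (∣⊥∣≡0 n)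

∣p∩⁅x⁆∣≡toℕ[x∈p] : ∀ {n} (p : Subset n) x → ∣ p ∩ ⁅ x ⁆ ∣ ≡ toℕ (lookup p x)
∣p∩⁅x⁆∣≡toℕ[x∈p] (true  ∷ p) zero    = cong suc (∣p∩⊥∣≡0 p)
∣p∩⁅x⁆∣≡toℕ[x∈p] (false ∷ p) zero    = ∣p∩⊥∣≡0 p
∣p∩⁅x⁆∣≡toℕ[x∈p] (true  ∷ p) (suc x) = ∣p∩⁅x⁆∣≡toℕ[x∈p] p x
∣p∩⁅x⁆∣≡toℕ[x∈p] (false ∷ p) (suc x) = ∣p∩⁅x⁆∣≡toℕ[x∈p] p x

∣p∩⊥∪⁅x⁆∣≡toℕ[x∈p] : ∀ {n} (p : Subset n) x → ∣ p ∩ (⊥ ∪ ⁅ x ⁆) ∣ ≡ toℕ (lookup p x)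
∣p∩⊥∪⁅x⁆∣≡toℕ[x∈p] p x = trans (cong (λ q → ∣ p ∩ q ∣) (∪-identityˡ ⁅ x ⁆)) (∣p∩⁅x⁆∣≡toℕ[x∈p] p x)

∣p∩⁅0⁆∪⁅1+y⁆∣ : ∀ {n} (p : Subset (suc n)) y →
                ∣ p ∩ (⁅ zero ⁆ ∪ ⁅ suc y ⁆) ∣ ≡ toℕ (lookup p zero) + toℕ (lookup p (suc y))
∣p∩⁅0⁆∪⁅1+y⁆∣ (true  ∷ p) y = cong suc (∣p∩⊥∪⁅x⁆∣≡toℕ[x∈p] p y)
∣p∩⁅0⁆∪⁅1+y⁆∣ (false ∷ p) y = ∣p∩⊥∪⁅x⁆∣≡toℕ[x∈p] p y

∣p∩⁅x⁆∪⁅y⁆∣ : ∀ {n} (p : Subset n) {x y} → x ≢ y →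
              ∣ p ∩ (⁅ x ⁆ ∪ ⁅ y ⁆) ∣ ≡ toℕ (lookup p x) + toℕ (lookup p y)
∣p∩⁅x⁆∪⁅y⁆∣ p           {zero}  {zero}  x≢y = contradiction refl x≢y
∣p∩⁅x⁆∪⁅y⁆∣ p           {zero}  {suc y} _   = ∣p∩⁅0⁆∪⁅1+y⁆∣ p y
∣p∩⁅x⁆∪⁅y⁆∣ p           {suc x} {zero}  _   = begin
  ∣ p ∩ (⁅ suc x ⁆ ∪ ⁅ zero ⁆) ∣                   ≡⟨ cong (λ q → ∣ p ∩ q ∣) (∪-comm ⁅ suc x ⁆ ⁅ zero ⁆) ⟩
  ∣ p ∩ (⁅ zero ⁆ ∪ ⁅ suc x ⁆) ∣                   ≡⟨ ∣p∩⁅0⁆∪⁅1+y⁆∣ p x ⟩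
  toℕ (lookup p zero) + toℕ (lookup p (suc x))     ≡⟨ +-comm (toℕ (lookup p zero)) _ ⟩
  toℕ (lookup p (suc x)) + toℕ (lookup p zero)     ∎
  where open ≡-Reasoning
∣p∩⁅x⁆∪⁅y⁆∣ (true  ∷ p) {suc x} {suc y} x≢y = ∣p∩⁅x⁆∪⁅y⁆∣ p (x≢y ∘ cong suc)
∣p∩⁅x⁆∪⁅y⁆∣ (false ∷ p) {suc x} {suc y} x≢y = ∣p∩⁅x⁆∪⁅y⁆∣ p (x≢y ∘ cong suc)

weighing-⁅x⁆∪⁅y⁆ : ∀ {n} (L R : Subset n) {x y} → x ≢ y →
                   weighing L R (⁅ x ⁆ ∪ ⁅ y ⁆)
                     ≡ reading (toℕ (lookup L x) + toℕ (lookup L y)) (toℕ (lookup R x) + toℕ (lookup R y))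
weighing-⁅x⁆∪⁅y⁆ L R x≢y = cong₂ reading (∣p∩⁅x⁆∪⁅y⁆∣ L x≢y) (∣p∩⁅x⁆∪⁅y⁆∣ R x≢y)

-- m coins placed among n: coin i of the pile is pos i, and emb s is the set of coins of s ⊆ Fin m.
record Pile (n m : ℕ) : Set where
  field
    pos            : Fin m → Fin n
    emb            : Subset m → Subset n
    lookup-emb-pos : ∀ s i → lookup (emb s) (pos i) ≡ lookup s i
    ∣emb∣          : ∀ s → ∣ emb s ∣ ≡ ∣ s ∣
    emb-∩          : ∀ s t → emb (s ∩ t) ≡ emb s ∩ emb t
    emb-⊥          : emb ⊥ ≡ ⊥
open Pile

leftPart : ∀ m n → Pile (m + n) m
leftPart m n = record
  { pos            = _↑ˡ n
  ; emb            = _++ ⊥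
  ; lookup-emb-pos = λ s i → lookup-++ˡ s ⊥ i
  ; ∣emb∣          = λ s → trans (∣p++q∣≡∣p∣+∣q∣ s ⊥) (trans (cong (∣ s ∣ +_) (∣⊥∣≡0 n)) (+-identityʳ ∣ s ∣))
  ; emb-∩          = λ s t → sym (trans (zipWith-++ _∧_ s ⊥ t ⊥) (cong ((s ∩ t) ++_) (∩-idem ⊥)))
  ; emb-⊥          = ⊥++⊥ m
  }

rightPart : ∀ m n → Pile (m + n) n
rightPart m n = record
  { pos            = m ↑ʳ_
  ; emb            = ⊥ ++_
  ; lookup-emb-pos = λ s i → lookup-++ʳ (⊥ {m}) s i
  ; ∣emb∣          = λ s → trans (∣p++q∣≡∣p∣+∣q∣ (⊥ {m}) s) (cong (_+ ∣ s ∣) (∣⊥∣≡0 m))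
  ; emb-∩          = λ s t → sym (trans (zipWith-++ _∧_ (⊥ {m}) s ⊥ t) (cong (_++ (s ∩ t)) (∩-idem ⊥)))
  ; emb-⊥          = ⊥++⊥ m
  }

infixr 9 _∘ᵖ_
_∘ᵖ_ : ∀ {n m l} → Pile n m → Pile m l → Pile n l
P ∘ᵖ Q = record
  { pos            = pos P ∘ pos Q
  ; emb            = emb P ∘ emb Q
  ; lookup-emb-pos = λ s i → trans (lookup-emb-pos P (emb Q s) (pos Q i)) (lookup-emb-pos Q s i)
  ; ∣emb∣          = λ s → trans (∣emb∣ P (emb Q s)) (∣emb∣ Q s)
  ; emb-∩          = λ s t → trans (cong (emb P) (emb-∩ Q s t)) (emb-∩ P (emb Q s) (emb Q t))
  ; emb-⊥          = trans (cong (emb P) (emb-⊥ Q)) (emb-⊥ P)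
  }

record Disjoint {n m l} (P : Pile n m) (Q : Pile n l) : Set where
  constructor mkDisjoint
  field emb-∩-emb : ∀ s t → emb P s ∩ emb Q t ≡ ⊥
open Disjoint

module _ {n m l} {P : Pile n m} {Q : Pile n l} where

  Disjoint-sym : Disjoint P Q → Disjoint Q P
  Disjoint-sym d = mkDisjoint λ s t → trans (∩-comm (emb Q s) (emb P t)) (emb-∩-emb d t s)

  ∘ᵖ-disjointˡ : ∀ {k} {P′ : Pile m k} → Disjoint P Q → Disjoint (P ∘ᵖ P′) Q
  ∘ᵖ-disjointˡ {P′ = P′} d = mkDisjoint λ s t → emb-∩-emb d (emb P′ s) t

  ∘ᵖ-disjointʳ : ∀ {k} {Q′ : Pile l k} → Disjoint P Q → Disjoint P (Q ∘ᵖ Q′)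
  ∘ᵖ-disjointʳ {Q′ = Q′} d = mkDisjoint λ s t → emb-∩-emb d s (emb Q′ t)

∘ᵖ-preserves-disjoint : ∀ {n m k l} (P : Pile n m) {Q : Pile m k} {Q′ : Pile m l} →
                        Disjoint Q Q′ → Disjoint (P ∘ᵖ Q) (P ∘ᵖ Q′)
∘ᵖ-preserves-disjoint P {Q} {Q′} d = mkDisjoint λ s t →
  trans (sym (emb-∩ P (emb Q s) (emb Q′ t))) (trans (cong (emb P) (emb-∩-emb d s t)) (emb-⊥ P))

leftPart-disjoint-rightPart : ∀ m n → Disjoint (leftPart m n) (rightPart m n)
leftPart-disjoint-rightPart m n = mkDisjoint λ s t →
  trans (zipWith-++ _∧_ s (⊥ {n}) (⊥ {m}) t) (trans (cong₂ _++_ (∩-zeroʳ s) (∩-zeroˡ t)) (⊥++⊥ m))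

lookup-emb-⊤ : ∀ {n m} (P : Pile n m) i → lookup (emb P ⊤) (pos P i) ≡ true
lookup-emb-⊤ P i = trans (lookup-emb-pos P ⊤ i) (lookup-replicate i true)

lookup-emb-disjoint : ∀ {n m l} {P : Pile n m} {Q : Pile n l} → Disjoint P Q →
                      ∀ s i → lookup (emb P s) (pos Q i) ≡ false
lookup-emb-disjoint {P = P} {Q} d s i = begin
  lookup (emb P s) (pos Q i)                              ≡⟨ sym (∧-identityʳ _) ⟩
  lookup (emb P s) (pos Q i) ∧ true                       ≡⟨ cong (_ ∧_) (sym (lookup-emb-⊤ Q i)) ⟩
  lookup (emb P s) (pos Q i) ∧ lookup (emb Q ⊤) (pos Q i) ≡⟨ sym (lookup-zipWith _∧_ (pos Q i) (emb P s) (emb Q ⊤)) ⟩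
  lookup (emb P s ∩ emb Q ⊤) (pos Q i)                    ≡⟨ cong (λ u → lookup u (pos Q i)) (emb-∩-emb d s ⊤) ⟩
  lookup ⊥ (pos Q i)                                      ≡⟨ lookup-replicate (pos Q i) false ⟩
  false                                                   ∎
  where open ≡-Reasoning

pos-disjoint : ∀ {n m l} {P : Pile n m} {Q : Pile n l} → Disjoint P Q → ∀ i j → pos P i ≢ pos Q j
pos-disjoint {P = P} {Q} d i j eq with () ←
  trans (sym (lookup-emb-⊤ P i)) (trans (cong (lookup (emb P ⊤)) eq) (lookup-emb-disjoint d ⊤ j))

block : ∀ {q} m → Fin q → Pile (q * m) m
block {suc q} m zero    = leftPart m (q * m)
block {suc q} m (suc p) = rightPart m (q * m) ∘ᵖ block m p

pos-block : ∀ {q} m (p : Fin q) i → pos (block m p) i ≡ combine p i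
pos-block {suc q} m zero    i = refl
pos-block {suc q} m (suc p) i = cong (m ↑ʳ_) (pos-block m p i)

block-disjoint : ∀ {q} m {p p′ : Fin q} → p ≢ p′ → Disjoint (block m p) (block m p′)
block-disjoint {suc q} m {zero}  {zero}   p≢p′ = contradiction refl p≢p′
block-disjoint {suc q} m {zero}  {suc p′} _    = ∘ᵖ-disjointʳ (leftPart-disjoint-rightPart m (q * m))
block-disjoint {suc q} m {suc p} {zero}   _    = Disjoint-sym (∘ᵖ-disjointʳ (leftPart-disjoint-rightPart m (q * m)))
block-disjoint {suc q} m {suc p} {suc p′} p≢p′ =
  ∘ᵖ-preserves-disjoint (rightPart m (q * m)) (block-disjoint m (p≢p′ ∘ cong suc))

data BlockView q m : Fin (q * m) → Set where
  inBlock : (p : Fin q) (i : Fin m) → BlockView q m (pos (block m p) i)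

blockView : ∀ q m (x : Fin (q * m)) → BlockView q m x
blockView q m x = subst (BlockView q m) (trans (pos-block m p i) (combine-remQuot {q} m x)) (inBlock p i)
  where
  p = proj₁ (remQuot {q} m x)
  i = proj₂ (remQuot {q} m x)

record Piles (n m : ℕ) (I : Set) : Set where
  field
    pile  : I → Pile n m
    apart : ∀ {a b} → a ≢ b → Disjoint (pile a) (pile b)
open Piles

blocks : ∀ q m → Piles (q * m) m (Fin q)
blocks q m = record { pile = block m ; apart = block-disjoint m }

restrict : ∀ {n m} {I J : Set} (f : J → I) → Injective _≡_ _≡_ f → Piles n m I → Piles n m J
restrict f f-injective P = record { pile = pile P ∘ f ; apart = λ a≢b → apart P (a≢b ∘ f-injective) }

module _ {n m} {I : Set} (P : Piles n m I) where

  pan : I → I → Subset n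
  pan a b = emb (pile P a) ⊤ ∪ emb (pile P b) ⊤

  pair : I → Fin m → I → Fin m → Subset n
  pair a i b j = ⁅ pos (pile P a) i ⁆ ∪ ⁅ pos (pile P b) j ⁆

  ∣pan∣ : ∀ {a b} → a ≢ b → ∣ pan a b ∣ ≡ m + m
  ∣pan∣ {a} {b} a≢b =
    trans (∣p∪q∣≡∣p∣+∣q∣ _ _ (emb-∩-emb (apart P a≢b) ⊤ ⊤))
          (cong₂ _+_ (trans (∣emb∣ (pile P a) ⊤) (∣⊤∣≡n m)) (trans (∣emb∣ (pile P b) ⊤) (∣⊤∣≡n m)))

  pan-∩-pan : ∀ {a b c d} → a ≢ c → a ≢ d → b ≢ c → b ≢ d → pan a b ∩ pan c d ≡ ⊥
  pan-∩-pan a≢c a≢d b≢c b≢d = ∪-∩-∪≡⊥ (disjoint a≢c) (disjoint a≢d) (disjoint b≢c) (disjoint b≢d)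
    where
    disjoint : ∀ {a b} → a ≢ b → emb (pile P a) ⊤ ∩ emb (pile P b) ⊤ ≡ ⊥
    disjoint a≢b = emb-∩-emb (apart P a≢b) ⊤ ⊤

module _ {I : Set} (_≟ᴵ_ : DecidableEquality I) where

  halves : ∀ {n m} → Piles n (2 * m) I → Piles n m (I × Fin 2)
  halves {m = m} P = record
    { pile  = λ x → pile P (proj₁ x) ∘ᵖ block m (proj₂ x)
    ; apart = halves-apart
    }
    where
    halves-apart : ∀ {x y} → x ≢ y →
                   Disjoint (pile P (proj₁ x) ∘ᵖ block m (proj₂ x)) (pile P (proj₁ y) ∘ᵖ block m (proj₂ y))
    halves-apart {a , h} {b , h′} x≢y with a ≟ᴵ b
    ... | yes refl = ∘ᵖ-preserves-disjoint (pile P a) (block-disjoint m (x≢y ∘ cong (a ,_)))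
    ... | no a≢b   = ∘ᵖ-disjointˡ (∘ᵖ-disjointʳ (apart P a≢b))

  onPan : I → I → I → ℕ
  onPan a b c = toℕ (does (a ≟ᴵ c) ∨ does (b ≟ᴵ c))

  panReading : I → I → I → I → I → I → Outcome
  panReading a b c d x y = reading (onPan a b x + onPan a b y) (onPan c d x + onPan c d y)

  module _ {n m} (P : Piles n m I) where

    lookup-pile : ∀ a c i → lookup (emb (pile P a) ⊤) (pos (pile P c) i) ≡ does (a ≟ᴵ c)
    lookup-pile a c i with a ≟ᴵ c
    ... | yes refl = lookup-emb-⊤ (pile P a) i
    ... | no a≢c   = lookup-emb-disjoint (apart P a≢c) ⊤ i

    toℕ-lookup-pan : ∀ a b c i → toℕ (lookup (pan P a b) (pos (pile P c) i)) ≡ onPan a b c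
    toℕ-lookup-pan a b c i =
      cong toℕ (trans (lookup-zipWith _∨_ (pos (pile P c) i) (emb (pile P a) ⊤) (emb (pile P b) ⊤))
                      (cong₂ _∨_ (lookup-pile a c i) (lookup-pile b c i)))

    weighing-pans : ∀ {x y} → x ≢ y → ∀ i j a b c d →
                    weighing (pan P a b) (pan P c d) (pair P x i y j) ≡ panReading a b c d x y
    weighing-pans {x} {y} x≢y i j a b c d =
      trans (weighing-⁅x⁆∪⁅y⁆ (pan P a b) (pan P c d) (pos-disjoint (apart P x≢y) i j))
            (cong₂ reading (cong₂ _+_ (toℕ-lookup-pan a b x i) (toℕ-lookup-pan a b y j))
                           (cong₂ _+_ (toℕ-lookup-pan c d x i) (toℕ-lookup-pan c d y j)))

weigh-AB-CD : ∀ {n m k} → Piles n m (Fin 4) → (Outcome → Strategy n k) → Strategy n (suc k)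
weigh-AB-CD P = node (pan P pA pB) (pan P pC pD)
                     (pan-∩-pan P (λ ()) (λ ()) (λ ()) (λ ()))
                     (trans (∣pan∣ P (λ ())) (sym (∣pan∣ P (λ ()))))

run-weigh-AB-CD : ∀ {n m k} (P : Piles n m (Fin 4)) (next : Outcome → Strategy n k) (S : Subset n) {o} →
                  weighing (pan P pA pB) (pan P pC pD) S ≡ o → run (next o) S ≡ S →
                  run (weigh-AB-CD P next) S ≡ S
run-weigh-AB-CD P next S refl run-o = run-o

pattern lower = zero
pattern upper = suc zero

_≟ʰ_ : DecidableEquality (Fin 4 × Fin 2)
_≟ʰ_ = ≡-dec _≟_ _≟_

-- The halves taking slots A, B, C, D after each reading of A₁ ∪ B₁ against C₁ ∪ D₁.  When only one
-- pair of halves is consistent with the reading, two unused halves fill the other pair of slots.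
select : Outcome → Fin 4 → Fin 4 × Fin 2
select muchLess = lookup ((pA , lower) ∷ (pB , lower) ∷ (pC , upper) ∷ (pD , upper) ∷ [])
select less     = lookup ((pA , lower) ∷ (pB , upper) ∷ (pA , upper) ∷ (pB , lower) ∷ [])
select equal    = lookup ((pA , upper) ∷ (pB , upper) ∷ (pC , upper) ∷ (pD , upper) ∷ [])
select more     = lookup ((pC , lower) ∷ (pD , upper) ∷ (pC , upper) ∷ (pD , lower) ∷ [])
select muchMore = lookup ((pC , lower) ∷ (pD , lower) ∷ (pA , upper) ∷ (pB , upper) ∷ [])

injective? : ∀ {m} {A : Set} → DecidableEquality A → (f : Fin m → A) → Dec (∀ i j → f i ≡ f j → i ≡ j)
injective? _≟ᴬ_ f = all? λ i → all? λ j → (f i ≟ᴬ f j) →-dec (i ≟ j)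

select-injective : ∀ o → Injective _≡_ _≡_ (select o)
select-injective o {i} {j} = toWitness (checked o) i j
  where
  checked : ∀ o → True (injective? _≟ʰ_ (select o))
  checked muchLess = _
  checked less     = _
  checked equal    = _
  checked more     = _
  checked muchMore = _

firstHalves : ∀ {n m} → Piles n (2 * m) (Fin 4) → Piles n m (Fin 4)
firstHalves P = restrict (_, lower) ,-injectiveˡ (halves _≟_ P)

narrow : ∀ {n m} → Outcome → Piles n (2 * m) (Fin 4) → Piles n m (Fin 4)
narrow o P = restrict (select o) (select-injective o) (halves _≟_ P)

answer : ∀ {n} → Piles n 1 (Fin 4) → Outcome → Subset n
answer P muchMore = pair P pC zero pD zero
answer P _        = pair P pA zero pB zero

solve : ∀ {n} j → Piles n (2 ^ j) (Fin 4) → Strategy n (suc j)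
solve zero    P = weigh-AB-CD P (leaf ∘ answer P)
solve (suc j) P = weigh-AB-CD (firstHalves {m = 2 ^ j} P) (λ o → solve j (narrow o P))

data Partners : Fin 4 → Fin 4 → Set where
  AB : Partners pA pB
  CD : Partners pC pD

partners-distinct : ∀ {p q} → Partners p q → p ≢ q
partners-distinct AB ()
partners-distinct CD ()

solve-correct : ∀ {n} j (P : Piles n (2 ^ j) (Fin 4)) {p q} → Partners p q → ∀ x y →
                run (solve j P) (pair P p x q y) ≡ pair P p x q y

solve-correct-halves : ∀ {n} j (P : Piles n (2 ^ suc j) (Fin 4)) {p q} → Partners p q →
                       ∀ {x y} → BlockView 2 (2 ^ j) x → BlockView 2 (2 ^ j) y →
                       run (solve (suc j) P) (pair P p x q y) ≡ pair P p x q y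

solve-correct zero P AB zero zero =
  run-weigh-AB-CD {k = 0} P (leaf ∘ answer P) (pair P pA zero pB zero)
    (weighing-pans _≟_ P (λ ()) zero zero pA pB pC pD) refl
solve-correct zero P CD zero zero =
  run-weigh-AB-CD {k = 0} P (leaf ∘ answer P) (pair P pC zero pD zero)
    (weighing-pans _≟_ P (λ ()) zero zero pA pB pC pD) refl
solve-correct (suc j) P pq x y = solve-correct-halves j P pq (blockView 2 (2 ^ j) x) (blockView 2 (2 ^ j) y)

solve-correct-halves {n} j P {p} {q} pq (inBlock h i) (inBlock h′ i′) =
  run-weigh-AB-CD (firstHalves {m = 2 ^ j} P) (λ o → solve j (narrow o P)) (S (p , h) (q , h′))
    (weighing-pans _≟ʰ_ H (partners-distinct pq ∘ ,-injectiveˡ) i i′ A₁ B₁ C₁ D₁)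
    (descend pq h h′)
  where
  H : Piles n (2 ^ j) (Fin 4 × Fin 2)
  H = halves _≟_ P
  A₁ B₁ C₁ D₁ : Fin 4 × Fin 2
  A₁ = pA , lower
  B₁ = pB , lower
  C₁ = pC , lower
  D₁ = pD , lower
  S : Fin 4 × Fin 2 → Fin 4 × Fin 2 → Subset n
  S x y = pair H x i y i′
  descend : ∀ {p q} → Partners p q → ∀ h h′ →
            run (solve j (narrow (panReading _≟ʰ_ A₁ B₁ C₁ D₁ (p , h) (q , h′)) P)) (S (p , h) (q , h′))
              ≡ S (p , h) (q , h′)
  descend AB lower lower = solve-correct j (narrow muchLess P) AB i i′
  descend AB lower upper = solve-correct j (narrow less P) AB i i′
  descend AB upper lower = solve-correct j (narrow less P) CD i i′
  descend AB upper upper = solve-correct j (narrow equal P) AB i i′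
  descend CD lower lower = solve-correct j (narrow muchMore P) AB i i′
  descend CD lower upper = solve-correct j (narrow more P) AB i i′
  descend CD upper lower = solve-correct j (narrow more P) CD i i′
  descend CD upper upper = solve-correct j (narrow equal P) CD i i′

mainTheorem3 : (k : ℕ) →
    Σ (Strategy (4 * 2 ^ k) (suc k))
      (λ σ → (S : Subset (4 * 2 ^ k)) → Admissible k S → run σ S ≡ S)
mainTheorem3 k = solve k piles , correct
  where
  piles : Piles (4 * 2 ^ k) (2 ^ k) (Fin 4)
  piles = blocks 4 (2 ^ k)
  correct : (S : Subset (4 * 2 ^ k)) → Admissible k S → run (solve k piles) S ≡ S
  correct _ (inj₁ (a , b , refl)) = solve-correct k piles AB a b
  correct _ (inj₂ (c , d , refl)) = solve-correct k piles CD c d
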